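{- Let $B$ be an $\varepsilon$-regular $2$-dimensional matrix of sizes $m\times n$ over a finite alphabet $\Sigma$ with densities $\rho_\sigma=\rho_\sigma(B)$, and let $\sigma\in\Sigma$. (i) Let $U$ be a set of v-lines of $B$, all of length $l\ge\varepsilon m$, which together compose a block of $B$. Then the number of v-lines of $U$ in which the density of $\sigma$ is strictly less than $\rho_\sigma-\varepsilon$ is less than $\varepsilon n$. (ii) Let $U$ be a set of h-lines of $B$, all of length $l\ge\varepsilon n$, which together compose a block of $B$. Then the number of h-lines of $U$ in which the density of $\sigma$ is strictly less than $\rho_\sigma-\varepsilon$ is less than $\varepsilon m$.
   Context: A block of a $2$-dimensional matrix is a submatrix (a set of rows and a set of columns). For a block $X$, $\rho_\sigma(X)$ is the fraction of its entries equal to $\sigma$. An $m\times n$ matrix $B$ is $\varepsilon$-regular if for every $\sigma$ and every block $Y$ of sizes $m'\times n'$ with $m'\ge\varepsilon m$, $n'\ge\varepsilon n$, $|\rho_\sigma(Y)-\rho_\sigma(B)|\le\varepsilon$. A v-line of length $l$ is a block of sizes $l\times1$ and an h-line of length $l$ is a block of sizes $1\times l$. A set of v-lines (h-lines) composes a block if their union is a block of $B$ (i.e. the v-lines all use the same set of rows, resp. the h-lines all use the same set of columns). -}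

module Defs where

open import Data.Nat as ℕ using (ℕ; zero; suc)
open import Data.Integer using (+_)
open import Data.Rational as ℚ using (ℚ; 0ℚ; _/_; _-_; _*_; _≤_; _<_; _<?_)
open import Data.Bool using (Bool; true; false; _∧_; if_then_else_)
open import Data.Fin using (Fin)
open import Data.Fin.Subset as S using (Subset; ⁅_⁆)
open import Data.Vec using (lookup)
open import Data.List using (List; map; allFin)
open import Data.Nat.ListAction using (sum)
open import Relation.Nullary.Decidable using (⌊_⌋)
open import Data.Fin.Properties using (_≟_)

Matrix : ℕ → ℕ → ℕ → Set
Matrix k m n = Fin m → Fin n → Fin k

ℕ→ℚ : ℕ → ℚ
ℕ→ℚ a = + a / 1

-- A block is given by a set of rows R and a set of columns C.
-- Number of entries of the block R × C equal to σ.
count : ∀ {k m n} → Matrix k m n → Fin k → Subset m → Subset n → ℕ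
count {k} {m} {n} B σ R C =
  sum (map (λ i → sum (map (λ j →
        if lookup R i ∧ lookup C j ∧ ⌊ B i j ≟ σ ⌋ then 1 else 0)
      (allFin n))) (allFin m))

-- c / d as a rational (d = 0 only for empty blocks; value 0 by convention)
ratio : ℕ → ℕ → ℚ
ratio c zero = 0ℚ
ratio c (suc d) = + c / suc d

ρ : ∀ {k m n} → Matrix k m n → Fin k → Subset m → Subset n → ℚ
ρ B σ R C = ratio (count B σ R C) (S.∣ R ∣ ℕ.* S.∣ C ∣)

ρB : ∀ {k m n} → Matrix k m n → Fin k → ℚ
ρB B σ = ρ B σ S.⊤ S.⊤

Regular : ∀ {k m n} → ℚ → Matrix k m n → Set
Regular {k} {m} {n} ε B =
  ∀ (σ : Fin k) (R : Subset m) (C : Subset n) →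
  ε * ℕ→ℚ m ≤ ℕ→ℚ S.∣ R ∣ → ε * ℕ→ℚ n ≤ ℕ→ℚ S.∣ C ∣ →
  ℚ.∣ ρ B σ R C - ρB B σ ∣ ≤ ε

-- (i) The set of v-lines {R × {c} : c ∈ C} (they compose the block R × C).
-- Number of those v-lines in which the density of σ is < ρ_σ(B) - ε.
badV : ∀ {k m n} → ℚ → Matrix k m n → Fin k → Subset m → Subset n → ℕ
badV {n = n} ε B σ R C =
  sum (map (λ c → if lookup C c ∧ ⌊ ρ B σ R ⁅ c ⁆ <? ρB B σ - ε ⌋ then 1 else 0)
           (allFin n))

-- (ii) The set of h-lines {{r} × C : r ∈ R}; number of those with density of σ < ρ_σ(B) - ε.
badH : ∀ {k m n} → ℚ → Matrix k m n → Fin k → Subset m → Subset n → ℕ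
badH {m = m} ε B σ R C =
  sum (map (λ r → if lookup R r ∧ ⌊ ρ B σ ⁅ r ⁆ C <? ρB B σ - ε ⌋ then 1 else 0)
           (allFin m))

{-# OPTIONS --safe #-}
-- If at least εn of the v-lines R × {j} (j ∈ C) had σ-density below ρ_σ − ε, then, as |R| ≥ εm,
-- these lines would compose a block R × D with |D| ≥ εn whose σ-density, being the average of
-- the densities of its lines, is also below ρ_σ − ε; this contradicts ε-regularity.
-- The h-lines of B are the v-lines of its transpose, which is ε-regular as well.
module Submission where

open import Defs
open import Data.Nat using (ℕ; NonZero)
open import Data.Fin using (Fin)
open import Data.Fin.Subset using (Subset; ∣_∣)
open import Data.Rational using (ℚ; 0ℚ; _*_; _≤_; _<_)
open import Data.Product using (_×_)

open import Algebra.Bundles using (CommutativeMonoid)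
open import Data.Bool using (Bool; true; false; _∧_; if_then_else_)
open import Data.Bool.Properties using (∧-zeroʳ; ∧-commutativeMonoid)
open import Data.Fin using (zero; suc)
open import Data.Fin.Properties using (_≟_)
open import Data.Fin.Subset using (_∈_; ⁅_⁆; ⊤)
open import Data.Fin.Subset.Properties using (∣⁅x⁆∣≡1)
open import Data.Integer as ℤ using (ℤ; +_)
import Data.Integer.Properties as ℤ
open import Data.List using (map; allFin)
import Data.List as List
open import Data.List.Properties using (map-cong; map-tabulate)
open import Data.Nat as ℕ using (suc)
open import Data.Nat.ListAction using () renaming (sum to listSum)
import Data.Nat.Properties as ℕ
open import Data.Product using (_,_)
import Data.Rational as ℚ
import Data.Rational.Properties as ℚ
open import Data.Rational.Solver using (module +-*-Solver)
import Data.Rational.Unnormalised as ℚᵘ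
import Data.Rational.Unnormalised.Properties as ℚᵘ
open import Data.Vec using (_∷_; []; lookup; tabulate; here; there)
open import Data.Vec.Properties using (lookup∘tabulate; []=⇒lookup)
open import Function using (_∘_; _⇔_; mk⇔; Equivalence)
open import Relation.Binary.PropositionalEquality
open import Relation.Nullary using (Dec; yes; no; ¬_; contradiction)
open import Relation.Nullary.Decidable using (⌊_⌋)
open import Algebra.Properties.CommutativeMonoid.Sum ℕ.+-0-commutativeMonoid using (sum-syntax; ∑-comm; sum-cong-≗; sum-replicate-zero)
open import Algebra.Properties.CommutativeSemigroup (CommutativeMonoid.commutativeSemigroup ∧-commutativeMonoid) using (x∙yz≈y∙xz)

sum-map-allFin : ∀ {n} (f : Fin n → ℕ) → listSum (map f (allFin n)) ≡ ∑[ i < n ] f i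
sum-map-allFin f = trans (cong listSum (map-tabulate (λ i → i) f)) (sum-tabulate f)
  where
  sum-tabulate : ∀ {n} (g : Fin n → ℕ) → listSum (List.tabulate g) ≡ ∑[ i < n ] g i
  sum-tabulate {ℕ.zero} g = refl
  sum-tabulate {suc n}  g = cong (g zero ℕ.+_) (sum-tabulate (g ∘ suc))

∣tabulate∣ : ∀ {n} (P : Fin n → Bool) → ∣ tabulate P ∣ ≡ ∑[ i < n ] (if P i then 1 else 0)
∣tabulate∣ {ℕ.zero} P = refl
∣tabulate∣ {suc n}  P with P zero
... | true  = cong suc (∣tabulate∣ (P ∘ suc))
... | false = ∣tabulate∣ (P ∘ suc)

sumOver : ∀ {n} → Subset n → (Fin n → ℕ) → ℕ
sumOver []          f = 0
sumOver (true ∷ p)  f = f zero ℕ.+ sumOver p (f ∘ suc)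
sumOver (false ∷ p) f = sumOver p (f ∘ suc)

sumOver-∑ : ∀ {n} (p : Subset n) (f : Fin n → ℕ) →
            sumOver p f ≡ ∑[ i < n ] (if lookup p i then f i else 0)
sumOver-∑ []          f = refl
sumOver-∑ (true ∷ p)  f = cong (f zero ℕ.+_) (sumOver-∑ p (f ∘ suc))
sumOver-∑ (false ∷ p) f = sumOver-∑ p (f ∘ suc)

sumOver-⁅⁆ : ∀ {n} (i : Fin n) (f : Fin n → ℕ) → sumOver ⁅ i ⁆ f ≡ f i
sumOver-⁅⁆ zero    f = trans (cong (f zero ℕ.+_) (sumOver-⊥ _ (f ∘ suc))) (ℕ.+-identityʳ (f zero))
  where
  sumOver-⊥ : ∀ n (g : Fin n → ℕ) → sumOver Data.Fin.Subset.⊥ g ≡ 0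
  sumOver-⊥ ℕ.zero  g = refl
  sumOver-⊥ (suc n) g = sumOver-⊥ n (g ∘ suc)
sumOver-⁅⁆ (suc i) f = sumOver-⁅⁆ i (f ∘ suc)

pos-+-* : ∀ a b (k : ℤ) → + (a ℕ.+ b) ℤ.* k ≡ + a ℤ.* k ℤ.+ + b ℤ.* k
pos-+-* a b k = trans (cong (ℤ._* k) (ℤ.pos-+ a b)) (ℤ.*-distribʳ-+ k (+ a) (+ b))

sumOver-≤ : ∀ {n} (p : Subset n) (f : Fin n → ℕ) {e k : ℤ} →
            (∀ {j} → j ∈ p → + f j ℤ.* e ℤ.≤ k) → + sumOver p f ℤ.* e ℤ.≤ + ∣ p ∣ ℤ.* k
sumOver-≤ []          f h = ℤ.≤-refl
sumOver-≤ (true ∷ p)  f {e} {k} h =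
  subst₂ ℤ._≤_ (sym (pos-+-* (f zero) _ e)) (sym (ℤ.suc-* (+ ∣ p ∣) k))
         (ℤ.+-mono-≤ (h here) (sumOver-≤ p (f ∘ suc) (h ∘ there)))
sumOver-≤ (false ∷ p) f h = sumOver-≤ p (f ∘ suc) (h ∘ there)

sumOver-< : ∀ {n} (p : Subset n) (f : Fin n → ℕ) {e k : ℤ} →
            (∀ {j} → j ∈ p → + f j ℤ.* e ℤ.< k) → 0 ℕ.< ∣ p ∣ →
            + sumOver p f ℤ.* e ℤ.< + ∣ p ∣ ℤ.* k
sumOver-< []          f h ()
sumOver-< (true ∷ p)  f {e} {k} h _ =
  subst₂ ℤ._<_ (sym (pos-+-* (f zero) _ e)) (sym (ℤ.suc-* (+ ∣ p ∣) k))
         (ℤ.+-mono-<-≤ (h here) (sumOver-≤ p (f ∘ suc) (ℤ.<⇒≤ ∘ h ∘ there)))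
sumOver-< (false ∷ p) f h 0<∣p∣ = sumOver-< p (f ∘ suc) (h ∘ there) 0<∣p∣

ratio<⇔ : ∀ x d t → ratio x (suc d) < t ⇔ (+ x ℤ.* ℚ.↧ t ℤ.< ℚ.↥ t ℤ.* + suc d)
ratio<⇔ x d t@record{} = mk⇔
  (λ x/d<t → unwrap (ℚᵘ.<-respˡ-≃ x/d≃ (ℚ.toℚᵘ-mono-< x/d<t)))
  (λ cross → ℚ.toℚᵘ-cancel-< (ℚᵘ.<-respˡ-≃ (ℚᵘ.≃-sym x/d≃) (ℚᵘ.*<* cross)))
  where
  x/d≃ : ℚ.toℚᵘ (ratio x (suc d)) ℚᵘ.≃ ℚᵘ.mkℚᵘ (+ x) d
  x/d≃ = ℚ.toℚᵘ-fromℚᵘ (ℚᵘ.mkℚᵘ (+ x) d)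
  unwrap : ∀ {p q} → p ℚᵘ.< q → ℚᵘ.↥ p ℤ.* ℚᵘ.↧ q ℤ.< ℚᵘ.↥ q ℤ.* ℚᵘ.↧ p
  unwrap (ℚᵘ.*<* p<q) = p<q

ratio-sumOver-< : ∀ {n} (p : Subset n) (f : Fin n → ℕ) r t →
                  (∀ {j} → j ∈ p → ratio (f j) (suc r) < t) →
                  ∀ {b} → ∣ p ∣ ≡ suc b → ratio (sumOver p f) (suc r ℕ.* suc b) < t
ratio-sumOver-< p f r t below {b} ∣p∣≡1+b =
  Equivalence.from (ratio<⇔ (sumOver p f) (b ℕ.+ r ℕ.* suc b) t)
    (subst (+ sumOver p f ℤ.* ℚ.↧ t ℤ.<_) rearrange
      (sumOver-< p f (λ {j} j∈p → Equivalence.to (ratio<⇔ (f j) r t) (below j∈p))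
                     (subst (0 ℕ.<_) (sym ∣p∣≡1+b) ℕ.z<s)))
  where
  open ≡-Reasoning
  a = ℚ.↥ t
  rearrange : + ∣ p ∣ ℤ.* (a ℤ.* + suc r) ≡ a ℤ.* + (suc r ℕ.* suc b)
  rearrange = begin
    + ∣ p ∣ ℤ.* (a ℤ.* + suc r)    ≡⟨ cong (λ c → + c ℤ.* (a ℤ.* + suc r)) ∣p∣≡1+b ⟩
    + suc b ℤ.* (a ℤ.* + suc r)    ≡⟨ ℤ.*-comm (+ suc b) (a ℤ.* + suc r) ⟩
    a ℤ.* + suc r ℤ.* + suc b      ≡⟨ ℤ.*-assoc a (+ suc r) (+ suc b) ⟩
    a ℤ.* (+ suc r ℤ.* + suc b)    ≡⟨ cong (a ℤ.*_) (ℤ.pos-* (suc r) (suc b)) ⟨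
    a ℤ.* + (suc r ℕ.* suc b)      ∎

*ℕ→ℚ-pos : ∀ {ε} n .{{_ : NonZero n}} → 0ℚ < ε → 0ℚ < ε * ℕ→ℚ n
*ℕ→ℚ-pos {ε} n 0<ε =
  ℚ.positive⁻¹ _ {{ℚ.pos*pos⇒pos ε {{ℚ.positive 0<ε}} (ℕ→ℚ n) {{ℚ.normalize-pos n 1}}}}

pos≤ℕ→ℚ⇒nonZero : ∀ {x} c → 0ℚ < x → x ≤ ℕ→ℚ c → NonZero c
pos≤ℕ→ℚ⇒nonZero ℕ.zero  0<x x≤0 = contradiction (ℚ.<-≤-trans 0<x x≤0) (ℚ.<-irrefl refl)
pos≤ℕ→ℚ⇒nonZero (suc c) _   _   = _

<-ε⇒ε<∣-∣ : ∀ {x y ε} → 0ℚ < ε → x < y ℚ.- ε → ε < ℚ.∣ x ℚ.- y ∣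
<-ε⇒ε<∣-∣ {x} {y} {ε} 0<ε x<y-ε = begin-strict
  ε                   <⟨ ε<y-x ⟩
  y ℚ.- x             ≡⟨ ℚ.0≤p⇒∣p∣≡p (ℚ.<⇒≤ (ℚ.<-trans 0<ε ε<y-x)) ⟨
  ℚ.∣ y ℚ.- x ∣       ≡⟨ cong ℚ.∣_∣ (solve 2 (λ x y → y :- x := :- (x :- y)) refl x y) ⟩
  ℚ.∣ ℚ.- (x ℚ.- y) ∣ ≡⟨ ℚ.∣-p∣≡∣p∣ (x ℚ.- y) ⟩
  ℚ.∣ x ℚ.- y ∣       ∎
  where
  open ℚ.≤-Reasoning
  open +-*-Solver
  ε<y-x : ε < y ℚ.- x
  ε<y-x = begin-strict
    ε                        ≡⟨ solve 2 (λ x ε → ε := x :+ (ε :- x)) refl x ε ⟩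
    x ℚ.+ (ε ℚ.- x)          <⟨ ℚ.+-monoˡ-< (ε ℚ.- x) x<y-ε ⟩
    (y ℚ.- ε) ℚ.+ (ε ℚ.- x)  ≡⟨ solve 3 (λ x y ε → (y :- ε) :+ (ε :- x) := y :- x) refl x y ε ⟩
    y ℚ.- x                  ∎

∧⌊⌋⇒ : ∀ {p} {P : Set p} a (d : Dec P) → a ∧ ⌊ d ⌋ ≡ true → P
∧⌊⌋⇒ true  (yes x) _  = x
∧⌊⌋⇒ true  (no _)  ()
∧⌊⌋⇒ false _       ()

module _ {k m n : ℕ} (B : Matrix k m n) (σ : Fin k) where

  indicator : Subset m → Subset n → Fin m → Fin n → ℕ
  indicator R C i j = if lookup R i ∧ lookup C j ∧ ⌊ B i j ≟ σ ⌋ then 1 else 0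

  count-∑ : ∀ R C → count B σ R C ≡ ∑[ i < m ] ∑[ j < n ] indicator R C i j
  count-∑ R C = trans (cong listSum (map-cong (sum-map-allFin ∘ indicator R C) (allFin m)))
                      (sum-map-allFin (λ i → ∑[ j < n ] indicator R C i j))

  columnCount : Subset m → Fin n → ℕ
  columnCount R j = ∑[ i < m ] (if lookup R i ∧ ⌊ B i j ≟ σ ⌋ then 1 else 0)

  count≡sumOver-columnCount : ∀ R C → count B σ R C ≡ sumOver C (columnCount R)
  count≡sumOver-columnCount R C = begin
    count B σ R C                                           ≡⟨ count-∑ R C ⟩
    ∑[ i < m ] ∑[ j < n ] indicator R C i j                 ≡⟨ ∑-comm (indicator R C) ⟩
    ∑[ j < n ] ∑[ i < m ] indicator R C i j                 ≡⟨ sum-cong-≗ (λ j → column (lookup C j) j) ⟩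
    ∑[ j < n ] (if lookup C j then columnCount R j else 0)  ≡⟨ sumOver-∑ C (columnCount R) ⟨
    sumOver C (columnCount R)                               ∎
    where
    open ≡-Reasoning
    column : ∀ c j → ∑[ i < m ] (if lookup R i ∧ c ∧ ⌊ B i j ≟ σ ⌋ then 1 else 0)
                     ≡ (if c then columnCount R j else 0)
    column true  j = refl
    column false j =
      trans (sum-cong-≗ (λ i → cong (λ b → if b then 1 else 0) (∧-zeroʳ (lookup R i))))
            (sum-replicate-zero m)

  count-columnCount : ∀ R j → count B σ R ⁅ j ⁆ ≡ columnCount R j
  count-columnCount R j = trans (count≡sumOver-columnCount R ⁅ j ⁆) (sumOver-⁅⁆ j (columnCount R))

transpose : ∀ {k m n} → Matrix k m n → Matrix k n m
transpose B j i = B i j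

module _ {k m n : ℕ} (B : Matrix k m n) (σ : Fin k) where

  count-transpose : ∀ R C → count (transpose B) σ C R ≡ count B σ R C
  count-transpose R C = begin
    count (transpose B) σ C R                                ≡⟨ count-∑ (transpose B) σ C R ⟩
    ∑[ j < n ] ∑[ i < m ] indicator (transpose B) σ C R j i  ≡⟨ ∑-comm (indicator (transpose B) σ C R) ⟩
    ∑[ i < m ] ∑[ j < n ] indicator (transpose B) σ C R j i  ≡⟨ sum-cong-≗ (λ i → sum-cong-≗ (swap-rows-columns i)) ⟩
    ∑[ i < m ] ∑[ j < n ] indicator B σ R C i j              ≡⟨ count-∑ B σ R C ⟨
    count B σ R C                                            ∎
    where
    open ≡-Reasoning
    swap-rows-columns : ∀ i j → indicator (transpose B) σ C R j i ≡ indicator B σ R C i j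
    swap-rows-columns i j =
      cong (λ b → if b then 1 else 0) (x∙yz≈y∙xz (lookup C j) (lookup R i) ⌊ B i j ≟ σ ⌋)

  ρ-transpose : ∀ R C → ρ (transpose B) σ C R ≡ ρ B σ R C
  ρ-transpose R C = cong₂ ratio (count-transpose R C) (ℕ.*-comm ∣ C ∣ ∣ R ∣)

regular-transpose : ∀ {k m n} {ε} {B : Matrix k m n} → Regular ε B → Regular ε (transpose B)
regular-transpose {ε = ε} {B} reg σ C R εn≤∣C∣ εm≤∣R∣ =
  subst₂ (λ x y → ℚ.∣ x ℚ.- y ∣ ≤ ε) (sym (ρ-transpose B σ R C)) (sym (ρ-transpose B σ ⊤ ⊤))
         (reg σ R C εm≤∣R∣ εn≤∣C∣)

badH≡badV-transpose : ∀ {k m n} ε (B : Matrix k m n) σ R C →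
                      badH ε B σ R C ≡ badV ε (transpose B) σ C R
badH≡badV-transpose {m = m} ε B σ R C = cong listSum (map-cong bad-row (allFin m))
  where
  bad-row : ∀ r →
    (if lookup R r ∧ ⌊ ρ B σ ⁅ r ⁆ C ℚ.<? ρB B σ ℚ.- ε ⌋ then 1 else 0) ≡
    (if lookup R r ∧ ⌊ ρ (transpose B) σ C ⁅ r ⁆ ℚ.<? ρB (transpose B) σ ℚ.- ε ⌋ then 1 else 0)
  bad-row r = cong₂ (λ x y → if lookup R r ∧ ⌊ x ℚ.<? y ℚ.- ε ⌋ then 1 else 0)
                    (sym (ρ-transpose B σ ⁅ r ⁆ C)) (sym (ρ-transpose B σ ⊤ ⊤))

regular⇒badV< : ∀ {k m n} .{{_ : NonZero m}} .{{_ : NonZero n}} (ε : ℚ) → 0ℚ < ε →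
                (B : Matrix k m n) → Regular ε B → (σ : Fin k) →
                ∀ R C → ε * ℕ→ℚ m ≤ ℕ→ℚ ∣ R ∣ → ℕ→ℚ (badV ε B σ R C) < ε * ℕ→ℚ n
regular⇒badV< {m = m} {n} ε 0<ε B reg σ R C εm≤∣R∣ = ℚ.≰⇒> many-bad⇒⊥
  where
  t = ρB B σ ℚ.- ε
  bad : Fin n → Bool
  bad j = lookup C j ∧ ⌊ ρ B σ R ⁅ j ⁆ ℚ.<? t ⌋
  D = tabulate bad

  many-bad⇒⊥ : ¬ (ε * ℕ→ℚ n ≤ ℕ→ℚ (badV ε B σ R C))
  many-bad⇒⊥ εn≤bad =
    ℚ.<-irrefl refl (ℚ.<-≤-trans (<-ε⇒ε<∣-∣ 0<ε block-below) (reg σ R D εm≤∣R∣ εn≤∣D∣))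
    where
    εn≤∣D∣ : ε * ℕ→ℚ n ≤ ℕ→ℚ ∣ D ∣
    εn≤∣D∣ = subst (λ c → ε * ℕ→ℚ n ≤ ℕ→ℚ c)
                   (trans (sum-map-allFin (λ j → if bad j then 1 else 0)) (sym (∣tabulate∣ bad)))
                   εn≤bad
    r = ℕ.pred ∣ R ∣
    ∣R∣≡1+r : ∣ R ∣ ≡ suc r
    ∣R∣≡1+r = sym (ℕ.suc-pred ∣ R ∣ {{pos≤ℕ→ℚ⇒nonZero ∣ R ∣ (*ℕ→ℚ-pos m 0<ε) εm≤∣R∣}})
    ∣D∣≡1+b : ∣ D ∣ ≡ suc (ℕ.pred ∣ D ∣)
    ∣D∣≡1+b = sym (ℕ.suc-pred ∣ D ∣ {{pos≤ℕ→ℚ⇒nonZero ∣ D ∣ (*ℕ→ℚ-pos n 0<ε) εn≤∣D∣}})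

    line-below : ∀ {j} → j ∈ D → ratio (columnCount B σ R j) (suc r) < t
    line-below {j} j∈D =
      subst (_< t) ρ≡ (∧⌊⌋⇒ (lookup C j) _ (trans (sym (lookup∘tabulate bad j)) ([]=⇒lookup j∈D)))
      where
      ρ≡ : ρ B σ R ⁅ j ⁆ ≡ ratio (columnCount B σ R j) (suc r)
      ρ≡ = cong₂ ratio (count-columnCount B σ R j)
                       (trans (cong₂ ℕ._*_ ∣R∣≡1+r (∣⁅x⁆∣≡1 j)) (ℕ.*-identityʳ (suc r)))

    block-below : ρ B σ R D < t
    block-below =
      subst (_< t) (sym (cong₂ ratio (count≡sumOver-columnCount B σ R D) (cong₂ ℕ._*_ ∣R∣≡1+r ∣D∣≡1+b)))
            (ratio-sumOver-< D (columnCount B σ R) r t line-below ∣D∣≡1+b)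

lemma6 : ∀ {k m n : ℕ} → .{{_ : NonZero m}} → .{{_ : NonZero n}} →
         (ε : ℚ) → 0ℚ < ε → (B : Matrix k m n) → Regular ε B → (σ : Fin k) →
         (∀ (R : Subset m) (C : Subset n) → ε * ℕ→ℚ m ≤ ℕ→ℚ ∣ R ∣ →
            ℕ→ℚ (badV ε B σ R C) < ε * ℕ→ℚ n)
         ×
         (∀ (R : Subset m) (C : Subset n) → ε * ℕ→ℚ n ≤ ℕ→ℚ ∣ C ∣ →
            ℕ→ℚ (badH ε B σ R C) < ε * ℕ→ℚ m)
lemma6 ε 0<ε B reg σ =
  regular⇒badV< ε 0<ε B reg σ ,
  λ R C εn≤∣C∣ → subst (λ c → ℕ→ℚ c < _) (sym (badH≡badV-transpose ε B σ R C))
                   (regular⇒badV< ε 0<ε (transpose B) (regular-transpose reg) σ C R εn≤∣C∣)
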